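{- Let $\mathbf{A}$ be a commutative bimonoid with transformation functions $\alpha,\beta\colon A\times A\to A$. Let $P$ be the algebra on $A\times A$ with operations $\overline{(a,b)}:=(\beta(a,b),\alpha(a,b))$, $(a,b)\circ(c,d):=(a\cdot c,b+d)$, $(a,b)\oplus(c,d):=(\beta(s,t),\alpha(s,t))$ where $s=\beta(a,b)\cdot\beta(c,d)$ and $t=\alpha(a,b)+\alpha(c,d)$, and constants $1^{\div}:=(1,0)$, $0^{\div}:=(0,0)$. Let $\preccurlyeq$ be the preorder on $A\times A$ given by $(a,b)\preccurlyeq(c,d)$ iff for all $x,y\in A$, $x\cdot c\leq y+d$ implies $x\cdot a\leq y+b$, and let $\theta$ be the equivalence relation induced by $\preccurlyeq$. Then $\theta$ is a congruence of $P$, and the ordered algebra $P/\theta$ ordered by $\preccurlyeq$ (with multiplication $\circ$, unit $1^{\div}$, addition $\oplus$, unit $0^{\div}$) is a commutative complemented bimonoid of fractions of $\mathbf{A}$ with respect to the embedding $\iota^{\div}\colon a\mapsto[(a,0)]_\theta$; moreover $\iota^{\div}(a)\circ\overline{\iota^{\div}(b)}=[(a,b)]_\theta$ for all $a,b\in A$, and the complement of $[(a,b)]_\theta$ is $[(\beta(a,b),\alpha(a,b))]_\theta$.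
   Context: A bimonoid $\langle A,\leq,\cdot,1,+,0\rangle$ is a poset with two monoid structures ($\cdot$ with unit $1$, $+$ with unit $0$), both operations order preserving in each argument, satisfying hemidistributivity $x\cdot(y+z)\leq(x\cdot y)+z$ and $(z+y)\cdot x\leq z+(y\cdot x)$; commutative if both operations are commutative. Embeddings are order embeddings preserving $\cdot,1,+,0$. In a commutative bimonoid, $y$ is a complement of $x$ if $x\cdot y\leq 0$ and $1\leq x+y$; unique if it exists, written $\overline{x}$; complemented means every element has one; complete means the order is a complete lattice. A commutative complemented Dedekind--MacNeille completion $\mathbf{A}^{\Delta}$ of $\mathbf{A}$ is a complete complemented commutative bimonoid containing $\mathbf{A}$ as a sub-bimonoid such that elements $a\cdot\overline{b}$ ($a,b\in\mathbf{A}$) are join dense and elements $a+\overline{b}$ are meet dense in it; it exists and is unique up to isomorphism over $\mathbf{A}$. Functions $\alpha,\beta\colon A\times A\to A$ are transformation functions for $\mathbf{A}$ if $a\cdot\overline{b}=\alpha(a,b)+\overline{\beta(a,b)}$ in $\mathbf{A}^{\Delta}$ for all $a,b\in A$. A commutative complemented bimonoid of fractions of $\mathbf{A}$ is a complemented commutative bimonoid $\mathbf{C}$ with an embedding $e\colon\mathbf{A}\hookrightarrow\mathbf{C}$ such that every element of $\mathbf{C}$ can be written as $e(a)\cdot\overline{e(b)}$ and as $e(c)+\overline{e(d)}$ for some $a,b,c,d\in\mathbf{A}$. -}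

module Defs where

open import Level using (Level; _⊔_; suc)
open import Data.Product using (Σ; ∃; _×_; _,_; proj₁; proj₂)
open import Relation.Unary using (Pred; _∈_)
open import Relation.Binary.Core using (Rel)
open import Relation.Binary.Structures using (IsPartialOrder)
open import Algebra.Definitions using (Associative; Commutative; LeftIdentity; RightIdentity; Congruent₂)

-- Commutative bimonoids (over a setoid, so that quotients can be
-- represented as the same carrier with a coarser equality _≈_).

record IsCommBimonoid {c ℓ : Level} {A : Set c} (_≈_ : Rel A ℓ) (_≤_ : Rel A ℓ)
         (_·_ : A → A → A) (one : A) (_+_ : A → A → A) (zero : A) : Set (c ⊔ ℓ) where
  field
    isPartialOrder : IsPartialOrder _≈_ _≤_
    ·-cong   : Congruent₂ _≈_ _·_
    +-cong   : Congruent₂ _≈_ _+_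
    ·-assoc  : Associative _≈_ _·_
    +-assoc  : Associative _≈_ _+_
    ·-identityˡ : LeftIdentity _≈_ one _·_
    ·-identityʳ : RightIdentity _≈_ one _·_
    +-identityˡ : LeftIdentity _≈_ zero _+_
    +-identityʳ : RightIdentity _≈_ zero _+_
    ·-comm   : Commutative _≈_ _·_
    +-comm   : Commutative _≈_ _+_
    ·-mono   : ∀ {x x' y y'} → x ≤ x' → y ≤ y' → (x · y) ≤ (x' · y')
    +-mono   : ∀ {x x' y y'} → x ≤ x' → y ≤ y' → (x + y) ≤ (x' + y')
    hemidistribˡ : ∀ x y z → (x · (y + z)) ≤ ((x · y) + z)
    hemidistribʳ : ∀ x y z → ((z + y) · x) ≤ (z + (y · x))

record CommBimonoid (c ℓ : Level) : Set (suc (c ⊔ ℓ)) where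
  infixl 7 _·_
  infixl 6 _+_
  infix 4 _≈_ _≤_
  field
    Carrier : Set c
    _≈_ : Rel Carrier ℓ
    _≤_ : Rel Carrier ℓ
    _·_ : Carrier → Carrier → Carrier
    one : Carrier
    _+_ : Carrier → Carrier → Carrier
    zero : Carrier
    isCommBimonoid : IsCommBimonoid _≈_ _≤_ _·_ one _+_ zero
  open IsCommBimonoid isCommBimonoid public

  IsComplement : Carrier → Carrier → Set ℓ
  IsComplement x y = (x · y ≤ zero) × (one ≤ x + y)

  IsComplementation : (Carrier → Carrier) → Set (c ⊔ ℓ)
  IsComplementation comp = ∀ x → IsComplement x (comp x)

  IsSup : {ℓS : Level} → Pred Carrier ℓS → Carrier → Set (c ⊔ ℓ ⊔ ℓS)
  IsSup S s = (∀ x → x ∈ S → x ≤ s) × (∀ u → (∀ x → x ∈ S → x ≤ u) → s ≤ u)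

  IsInf : {ℓS : Level} → Pred Carrier ℓS → Carrier → Set (c ⊔ ℓ ⊔ ℓS)
  IsInf S s = (∀ x → x ∈ S → s ≤ x) × (∀ u → (∀ x → x ∈ S → u ≤ x) → u ≤ s)

  IsComplete : Set (suc c ⊔ ℓ)
  IsComplete = (∀ (S : Pred Carrier c) → ∃ λ s → IsSup S s)
             × (∀ (S : Pred Carrier c) → ∃ λ s → IsInf S s)

record IsEmbedding {a ℓa c ℓc : Level} (A : CommBimonoid a ℓa) (C : CommBimonoid c ℓc)
         (e : CommBimonoid.Carrier A → CommBimonoid.Carrier C) : Set (a ⊔ ℓa ⊔ ℓc) where
  private
    module A = CommBimonoid A
    module C = CommBimonoid C
  field
    cong       : ∀ {x y} → x A.≈ y → e x C.≈ e y
    order-emb  : ∀ {x y} → (x A.≤ y → e x C.≤ e y) × (e x C.≤ e y → x A.≤ y)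
    pres-·     : ∀ x y → e (x A.· y) C.≈ (e x C.· e y)
    pres-one   : e A.one C.≈ C.one
    pres-+     : ∀ x y → e (x A.+ y) C.≈ (e x C.+ e y)
    pres-zero  : e A.zero C.≈ C.zero

record IsDMCompletion {a ℓa d ℓd : Level} (A : CommBimonoid a ℓa) (D : CommBimonoid d ℓd)
         (j : CommBimonoid.Carrier A → CommBimonoid.Carrier D)
         (comp : CommBimonoid.Carrier D → CommBimonoid.Carrier D) : Set (a ⊔ ℓa ⊔ suc d ⊔ ℓd) where
  private
    module A = CommBimonoid A
    module D = CommBimonoid D
  field
    embedding      : IsEmbedding A D j
    complete       : D.IsComplete
    complemented   : D.IsComplementation comp
    joinDense : ∀ x → D.IsSup (λ y → ∃ λ ab → (y D.≈ j (proj₁ ab) D.· comp (j (proj₂ ab))) × (y D.≤ x)) x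
    meetDense : ∀ x → D.IsInf (λ y → ∃ λ ab → (y D.≈ j (proj₁ ab) D.+ comp (j (proj₂ ab))) × (x D.≤ y)) x

-- α, β are transformation functions for A, witnessed by a commutative
-- complemented Dedekind–MacNeille completion (unique up to iso over A).
record TransformationFunctions {a ℓa : Level} (d ℓd : Level) (A : CommBimonoid a ℓa)
         (α β : CommBimonoid.Carrier A → CommBimonoid.Carrier A → CommBimonoid.Carrier A)
         : Set (suc (a ⊔ ℓa ⊔ d ⊔ ℓd)) where
  field
    D    : CommBimonoid d ℓd
    j    : CommBimonoid.Carrier A → CommBimonoid.Carrier D
    comp : CommBimonoid.Carrier D → CommBimonoid.Carrier D
    isDM : IsDMCompletion A D j comp
    transform : ∀ x y →
      CommBimonoid._≈_ D (CommBimonoid._·_ D (j x) (comp (j y)))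
                         (CommBimonoid._+_ D (j (α x y)) (comp (j (β x y))))

record IsBimonoidOfFractions {a ℓa c ℓc : Level} (A : CommBimonoid a ℓa) (C : CommBimonoid c ℓc)
         (comp : CommBimonoid.Carrier C → CommBimonoid.Carrier C)
         (e : CommBimonoid.Carrier A → CommBimonoid.Carrier C) : Set (a ⊔ ℓa ⊔ c ⊔ ℓc) where
  private
    module A = CommBimonoid A
    module C = CommBimonoid C
  field
    complemented : C.IsComplementation comp
    embedding    : IsEmbedding A C e
    fraction-·   : ∀ x → ∃ λ (ab : A.Carrier × A.Carrier) → x C.≈ e (proj₁ ab) C.· comp (e (proj₂ ab))
    fraction-+   : ∀ x → ∃ λ (cd : A.Carrier × A.Carrier) → x C.≈ e (proj₁ cd) C.+ comp (e (proj₂ cd))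

module FractionAlgebra {a ℓa : Level} (A : CommBimonoid a ℓa)
         (α β : CommBimonoid.Carrier A → CommBimonoid.Carrier A → CommBimonoid.Carrier A) where
  open CommBimonoid A

  P : Set a
  P = Carrier × Carrier

  bar : P → P
  bar (x , y) = (β x y , α x y)

  _∘_ : P → P → P
  (x , y) ∘ (u , v) = (x · u , y + v)

  _⊕_ : P → P → P
  (x , y) ⊕ (u , v) = (β s t , α s t)
    where
      s = β x y · β u v
      t = α x y + α u v

  one÷ : P
  one÷ = (one , zero)

  zero÷ : P
  zero÷ = (zero , zero)

  _≼_ : P → P → Set (a ⊔ ℓa)
  (x , y) ≼ (u , v) = ∀ p q → p · u ≤ q + v → p · x ≤ q + y

  _θ_ : P → P → Set (a ⊔ ℓa)
  p θ q = (p ≼ q) × (q ≼ p)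

  ι÷ : Carrier → P
  ι÷ x = (x , zero)

  -- the quotient P/θ, represented as the setoid (P, θ) ordered by ≼,
  -- given a proof that it is a commutative bimonoid (θ a congruence etc.)
  P/θ : IsCommBimonoid _θ_ _≼_ _∘_ one÷ _⊕_ zero÷ → CommBimonoid a (a ⊔ ℓa)
  P/θ isB = record { Carrier = P ; _≈_ = _θ_ ; _≤_ = _≼_ ; _·_ = _∘_ ; one = one÷
                   ; _+_ = _⊕_ ; zero = zero÷ ; isCommBimonoid = isB }

-- Map a pair (a , b) to the fraction φ (a , b) = j a · ¬ (j b) in the
-- Dedekind–MacNeille completion D. Residuation in D (x · z ≤ y iff
-- x ≤ y + ¬ z) turns the defining condition of (a , b) ≼ (c , d) into
-- "every meet-dense element j y + ¬ (j x) above φ (c , d) lies above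
-- φ (a , b)", so by meet density ≼ is exactly the order of D pulled back
-- along φ. The transformation functions make φ turn ∘, ⊕ and bar into
-- ·, + and ¬ of D, hence P/θ is isomorphic to the image of φ, a complemented
-- sub-bimonoid of D in which every element is both some j a · ¬ (j b) and
-- some j c + ¬ (j d).
module Submission where

open import Defs
open import Level using (Level)
open import Data.Product using (Σ; _×_; _,_; proj₁; proj₂)
open import Relation.Binary.Core using (Rel)
open import Relation.Binary.Bundles using (Poset)
import Relation.Binary.Reasoning.PartialOrder as PosetReasoning

module Complemented {d ℓd : Level} (D : CommBimonoid d ℓd)
    (¬_ : CommBimonoid.Carrier D → CommBimonoid.Carrier D)
    (complemented : CommBimonoid.IsComplementation D ¬_) where
  open CommBimonoid D

  poset : Poset d ℓd ℓd
  poset = record { isPartialOrder = isPartialOrder }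

  open Poset poset public using (module Eq; reflexive; antisym)
    renaming (refl to ≤-refl)
  open PosetReasoning poset

  ·¬≤zero : ∀ x → x · ¬ x ≤ zero
  ·¬≤zero x = proj₁ (complemented x)

  one≤+¬ : ∀ x → one ≤ x + ¬ x
  one≤+¬ x = proj₂ (complemented x)

  ·≤⇒≤+¬ : ∀ {x y z} → x · z ≤ y → x ≤ y + ¬ z
  ·≤⇒≤+¬ {x} {y} {z} h = begin
    x             ≈⟨ Eq.sym (·-identityʳ x) ⟩
    x · one       ≤⟨ ·-mono ≤-refl (one≤+¬ z) ⟩
    x · (z + ¬ z) ≤⟨ hemidistribˡ x z (¬ z) ⟩
    x · z + ¬ z   ≤⟨ +-mono h ≤-refl ⟩
    y + ¬ z       ∎

  ≤+¬⇒·≤ : ∀ {x y z} → x ≤ y + ¬ z → x · z ≤ y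
  ≤+¬⇒·≤ {x} {y} {z} h = begin
    x · z         ≤⟨ ·-mono h ≤-refl ⟩
    (y + ¬ z) · z ≤⟨ hemidistribʳ z (¬ z) y ⟩
    y + ¬ z · z   ≈⟨ +-cong Eq.refl (·-comm (¬ z) z) ⟩
    y + z · ¬ z   ≤⟨ +-mono ≤-refl (·¬≤zero z) ⟩
    y + zero      ≈⟨ +-identityʳ y ⟩
    y             ∎

  ≤+⇒·¬≤ : ∀ {x y z} → x ≤ y + z → x · ¬ z ≤ y
  ≤+⇒·¬≤ {x} {y} {z} h = begin
    x · ¬ z       ≤⟨ ·-mono h ≤-refl ⟩
    (y + z) · ¬ z ≤⟨ hemidistribʳ (¬ z) z y ⟩
    y + z · ¬ z   ≤⟨ +-mono ≤-refl (·¬≤zero z) ⟩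
    y + zero      ≈⟨ +-identityʳ y ⟩
    y             ∎

  ·¬≤⇒≤+ : ∀ {x y z} → x · ¬ z ≤ y → x ≤ y + z
  ·¬≤⇒≤+ {x} {y} {z} h = begin
    x             ≈⟨ Eq.sym (·-identityʳ x) ⟩
    x · one       ≤⟨ ·-mono ≤-refl (one≤+¬ z) ⟩
    x · (z + ¬ z) ≈⟨ ·-cong Eq.refl (+-comm z (¬ z)) ⟩
    x · (¬ z + z) ≤⟨ hemidistribˡ x (¬ z) z ⟩
    x · ¬ z + z   ≤⟨ +-mono h ≤-refl ⟩
    y + z         ∎

  complement-≤ : ∀ {x y y'} → IsComplement x y → IsComplement x y' → y ≤ y'
  complement-≤ {x} {y} {y'} (xy≤zero , _) (_ , one≤xy') = begin
    y            ≈⟨ Eq.sym (·-identityʳ y) ⟩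
    y · one      ≤⟨ ·-mono ≤-refl one≤xy' ⟩
    y · (x + y') ≤⟨ hemidistribˡ y x y' ⟩
    y · x + y'   ≈⟨ +-cong (·-comm y x) Eq.refl ⟩
    x · y + y'   ≤⟨ +-mono xy≤zero ≤-refl ⟩
    zero + y'    ≈⟨ +-identityˡ y' ⟩
    y'           ∎

  complement-unique : ∀ {x y} → IsComplement x y → ¬ x ≈ y
  complement-unique h = antisym (complement-≤ (complemented _) h) (complement-≤ h (complemented _))

  ¬-cong : ∀ {x x'} → x ≈ x' → ¬ x ≈ ¬ x'
  ¬-cong {x} {x'} x≈x' = complement-unique
    ( (begin x · ¬ x' ≈⟨ ·-cong x≈x' Eq.refl ⟩ x' · ¬ x' ≤⟨ ·¬≤zero x' ⟩ zero ∎)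
    , (begin one ≤⟨ one≤+¬ x' ⟩ x' + ¬ x' ≈⟨ +-cong (Eq.sym x≈x') Eq.refl ⟩ x + ¬ x' ∎) )

  ¬-involutive : ∀ x → ¬ ¬ x ≈ x
  ¬-involutive x = complement-unique
    ( (begin ¬ x · x ≈⟨ ·-comm (¬ x) x ⟩ x · ¬ x ≤⟨ ·¬≤zero x ⟩ zero ∎)
    , (begin one ≤⟨ one≤+¬ x ⟩ x + ¬ x ≈⟨ +-comm x (¬ x) ⟩ ¬ x + x ∎) )

  ¬-zero : ¬ zero ≈ one
  ¬-zero = complement-unique (reflexive (·-identityʳ zero) , reflexive (Eq.sym (+-identityˡ one)))

  ¬-+ : ∀ x y → ¬ (x + y) ≈ ¬ x · ¬ y
  ¬-+ x y = complement-unique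
    ( (begin
        (x + y) · (¬ x · ¬ y) ≈⟨ ·-cong Eq.refl (·-comm (¬ x) (¬ y)) ⟩
        (x + y) · (¬ y · ¬ x) ≈⟨ Eq.sym (·-assoc (x + y) (¬ y) (¬ x)) ⟩
        (x + y) · ¬ y · ¬ x   ≤⟨ ·-mono (≤+⇒·¬≤ ≤-refl) ≤-refl ⟩
        x · ¬ x               ≤⟨ ·¬≤zero x ⟩
        zero                  ∎)
    , (begin
        one                   ≤⟨ one≤+¬ x ⟩
        x + ¬ x               ≤⟨ +-mono ≤-refl (·¬≤⇒≤+ ≤-refl) ⟩
        x + (¬ x · ¬ y + y)   ≈⟨ +-cong Eq.refl (+-comm _ y) ⟩
        x + (y + ¬ x · ¬ y)   ≈⟨ Eq.sym (+-assoc x y _) ⟩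
        x + y + ¬ x · ¬ y     ∎) )

  ¬-· : ∀ x y → ¬ (x · y) ≈ ¬ x + ¬ y
  ¬-· x y = begin-equality
    ¬ (x · y)             ≈⟨ ¬-cong (·-cong (Eq.sym (¬-involutive x)) (Eq.sym (¬-involutive y))) ⟩
    ¬ (¬ ¬ x · ¬ ¬ y)     ≈⟨ ¬-cong (Eq.sym (¬-+ (¬ x) (¬ y))) ⟩
    ¬ ¬ (¬ x + ¬ y)       ≈⟨ ¬-involutive _ ⟩
    ¬ x + ¬ y             ∎

  ·-interchange : ∀ x y u v → (x · y) · (u · v) ≈ (x · u) · (y · v)
  ·-interchange x y u v = begin-equality
    (x · y) · (u · v) ≈⟨ ·-assoc x y (u · v) ⟩
    x · (y · (u · v)) ≈⟨ ·-cong Eq.refl (Eq.sym (·-assoc y u v)) ⟩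
    x · ((y · u) · v) ≈⟨ ·-cong Eq.refl (·-cong (·-comm y u) Eq.refl) ⟩
    x · ((u · y) · v) ≈⟨ ·-cong Eq.refl (·-assoc u y v) ⟩
    x · (u · (y · v)) ≈⟨ Eq.sym (·-assoc x u (y · v)) ⟩
    (x · u) · (y · v) ∎

module PullBack {d ℓd p ℓ : Level} (D : CommBimonoid d ℓd) {P : Set p}
    (_≼_ : Rel P ℓ) (_∘_ _⊕_ : P → P → P) (one÷ zero÷ : P)
    (φ : P → CommBimonoid.Carrier D)
    (≼⇒≤ : ∀ {p q} → p ≼ q → CommBimonoid._≤_ D (φ p) (φ q))
    (≤⇒≼ : ∀ {p q} → CommBimonoid._≤_ D (φ p) (φ q) → p ≼ q)
    (φ-∘ : ∀ p q → CommBimonoid._≈_ D (φ (p ∘ q)) (CommBimonoid._·_ D (φ p) (φ q)))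
    (φ-⊕ : ∀ p q → CommBimonoid._≈_ D (φ (p ⊕ q)) (CommBimonoid._+_ D (φ p) (φ q)))
    (φ-one : CommBimonoid._≈_ D (φ one÷) (CommBimonoid.one D))
    (φ-zero : CommBimonoid._≈_ D (φ zero÷) (CommBimonoid.zero D)) where
  open CommBimonoid D hiding (isCommBimonoid)
  private
    poset : Poset d ℓd ℓd
    poset = record { isPartialOrder = isPartialOrder }
    module D≤ = Poset poset
    module Eq = D≤.Eq
  open PosetReasoning poset

  _≋_ : Rel P ℓ
  p ≋ q = (p ≼ q) × (q ≼ p)

  ≈⇒≋ : ∀ {p q} → φ p ≈ φ q → p ≋ q
  ≈⇒≋ e = ≤⇒≼ (D≤.reflexive e) , ≤⇒≼ (D≤.reflexive (Eq.sym e))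

  ≋⇒≈ : ∀ {p q} → p ≋ q → φ p ≈ φ q
  ≋⇒≈ (p≼q , q≼p) = D≤.antisym (≼⇒≤ p≼q) (≼⇒≤ q≼p)

  ≼-trans : ∀ {p q r} → p ≼ q → q ≼ r → p ≼ r
  ≼-trans p≼q q≼r = ≤⇒≼ (D≤.trans (≼⇒≤ p≼q) (≼⇒≤ q≼r))

  ≼-refl : ∀ {p} → p ≼ p
  ≼-refl = ≤⇒≼ D≤.refl

  φ-∘-cong : ∀ {p p' q q'} → φ p ≈ φ p' → φ q ≈ φ q' → φ (p ∘ q) ≈ φ (p' ∘ q')
  φ-∘-cong {p} {p'} {q} {q'} e₁ e₂ = begin-equality
    φ (p ∘ q)   ≈⟨ φ-∘ p q ⟩
    φ p · φ q   ≈⟨ ·-cong e₁ e₂ ⟩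
    φ p' · φ q' ≈⟨ Eq.sym (φ-∘ p' q') ⟩
    φ (p' ∘ q') ∎

  φ-⊕-cong : ∀ {p p' q q'} → φ p ≈ φ p' → φ q ≈ φ q' → φ (p ⊕ q) ≈ φ (p' ⊕ q')
  φ-⊕-cong {p} {p'} {q} {q'} e₁ e₂ = begin-equality
    φ (p ⊕ q)   ≈⟨ φ-⊕ p q ⟩
    φ p + φ q   ≈⟨ +-cong e₁ e₂ ⟩
    φ p' + φ q' ≈⟨ Eq.sym (φ-⊕ p' q') ⟩
    φ (p' ⊕ q') ∎

  isCommBimonoid : IsCommBimonoid _≋_ _≼_ _∘_ one÷ _⊕_ zero÷
  isCommBimonoid = record
    { isPartialOrder = record
        { isPreorder = record
            { isEquivalence = record
                { refl  = ≼-refl , ≼-refl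
                ; sym   = λ (p≼q , q≼p) → q≼p , p≼q
                ; trans = λ (p≼q , q≼p) (q≼r , r≼q) → ≼-trans p≼q q≼r , ≼-trans r≼q q≼p }
            ; reflexive = proj₁
            ; trans     = ≼-trans }
        ; antisym = _,_ }
    ; ·-cong = λ e₁ e₂ → ≈⇒≋ (φ-∘-cong (≋⇒≈ e₁) (≋⇒≈ e₂))
    ; +-cong = λ e₁ e₂ → ≈⇒≋ (φ-⊕-cong (≋⇒≈ e₁) (≋⇒≈ e₂))
    ; ·-assoc = λ p q r → ≈⇒≋ (begin-equality
        φ ((p ∘ q) ∘ r)   ≈⟨ Eq.trans (φ-∘ _ r) (·-cong (φ-∘ p q) Eq.refl) ⟩
        φ p · φ q · φ r   ≈⟨ ·-assoc _ _ _ ⟩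
        φ p · (φ q · φ r) ≈⟨ Eq.sym (Eq.trans (φ-∘ p _) (·-cong Eq.refl (φ-∘ q r))) ⟩
        φ (p ∘ (q ∘ r))   ∎)
    ; +-assoc = λ p q r → ≈⇒≋ (begin-equality
        φ ((p ⊕ q) ⊕ r)   ≈⟨ Eq.trans (φ-⊕ _ r) (+-cong (φ-⊕ p q) Eq.refl) ⟩
        φ p + φ q + φ r   ≈⟨ +-assoc _ _ _ ⟩
        φ p + (φ q + φ r) ≈⟨ Eq.sym (Eq.trans (φ-⊕ p _) (+-cong Eq.refl (φ-⊕ q r))) ⟩
        φ (p ⊕ (q ⊕ r))   ∎)
    ; ·-identityˡ = λ p → ≈⇒≋ (Eq.trans (φ-∘ one÷ p) (Eq.trans (·-cong φ-one Eq.refl) (·-identityˡ _)))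
    ; ·-identityʳ = λ p → ≈⇒≋ (Eq.trans (φ-∘ p one÷) (Eq.trans (·-cong Eq.refl φ-one) (·-identityʳ _)))
    ; +-identityˡ = λ p → ≈⇒≋ (Eq.trans (φ-⊕ zero÷ p) (Eq.trans (+-cong φ-zero Eq.refl) (+-identityˡ _)))
    ; +-identityʳ = λ p → ≈⇒≋ (Eq.trans (φ-⊕ p zero÷) (Eq.trans (+-cong Eq.refl φ-zero) (+-identityʳ _)))
    ; ·-comm = λ p q → ≈⇒≋ (Eq.trans (φ-∘ p q) (Eq.trans (·-comm _ _) (Eq.sym (φ-∘ q p))))
    ; +-comm = λ p q → ≈⇒≋ (Eq.trans (φ-⊕ p q) (Eq.trans (+-comm _ _) (Eq.sym (φ-⊕ q p))))
    ; ·-mono = λ {p} {p'} {q} {q'} h₁ h₂ → ≤⇒≼ (begin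
        φ (p ∘ q)   ≈⟨ φ-∘ p q ⟩
        φ p · φ q   ≤⟨ ·-mono (≼⇒≤ h₁) (≼⇒≤ h₂) ⟩
        φ p' · φ q' ≈⟨ Eq.sym (φ-∘ p' q') ⟩
        φ (p' ∘ q') ∎)
    ; +-mono = λ {p} {p'} {q} {q'} h₁ h₂ → ≤⇒≼ (begin
        φ (p ⊕ q)   ≈⟨ φ-⊕ p q ⟩
        φ p + φ q   ≤⟨ +-mono (≼⇒≤ h₁) (≼⇒≤ h₂) ⟩
        φ p' + φ q' ≈⟨ Eq.sym (φ-⊕ p' q') ⟩
        φ (p' ⊕ q') ∎)
    ; hemidistribˡ = λ p q r → ≤⇒≼ (begin
        φ (p ∘ (q ⊕ r))   ≈⟨ Eq.trans (φ-∘ p _) (·-cong Eq.refl (φ-⊕ q r)) ⟩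
        φ p · (φ q + φ r) ≤⟨ hemidistribˡ _ _ _ ⟩
        φ p · φ q + φ r   ≈⟨ Eq.sym (Eq.trans (φ-⊕ _ r) (+-cong (φ-∘ p q) Eq.refl)) ⟩
        φ ((p ∘ q) ⊕ r)   ∎)
    ; hemidistribʳ = λ p q r → ≤⇒≼ (begin
        φ ((r ⊕ q) ∘ p)   ≈⟨ Eq.trans (φ-∘ _ p) (·-cong (φ-⊕ r q) Eq.refl) ⟩
        (φ r + φ q) · φ p ≤⟨ hemidistribʳ _ _ _ ⟩
        φ r + φ q · φ p   ≈⟨ Eq.sym (Eq.trans (φ-⊕ r _) (+-cong Eq.refl (φ-∘ q p))) ⟩
        φ (r ⊕ (q ∘ p))   ∎)
    }

  pulledBack : CommBimonoid p ℓ
  pulledBack = record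
    { Carrier = P ; _≈_ = _≋_ ; _≤_ = _≼_ ; _·_ = _∘_ ; one = one÷
    ; _+_ = _⊕_ ; zero = zero÷ ; isCommBimonoid = isCommBimonoid }

  module _ (¬_ : Carrier → Carrier) (bar : P → P)
           (φ-bar : ∀ p → φ (bar p) ≈ ¬ φ p) where

    bar-cong : (∀ {x y} → x ≈ y → ¬ x ≈ ¬ y) → ∀ {p q} → p ≋ q → bar p ≋ bar q
    bar-cong ¬-cong {p} {q} e =
      ≈⇒≋ (Eq.trans (φ-bar p) (Eq.trans (¬-cong (≋⇒≈ e)) (Eq.sym (φ-bar q))))

    bar-isComplementation : IsComplementation ¬_ → CommBimonoid.IsComplementation pulledBack bar
    bar-isComplementation complemented p =
        ≤⇒≼ (begin
          φ (p ∘ bar p) ≈⟨ Eq.trans (φ-∘ p _) (·-cong Eq.refl (φ-bar p)) ⟩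
          φ p · ¬ φ p   ≤⟨ proj₁ (complemented (φ p)) ⟩
          zero          ≈⟨ Eq.sym φ-zero ⟩
          φ zero÷       ∎)
      , ≤⇒≼ (begin
          φ one÷        ≈⟨ φ-one ⟩
          one           ≤⟨ proj₂ (complemented (φ p)) ⟩
          φ p + ¬ φ p   ≈⟨ Eq.sym (Eq.trans (φ-⊕ p _) (+-cong Eq.refl (φ-bar p))) ⟩
          φ (p ⊕ bar p) ∎)

  ι-isEmbedding : ∀ {a ℓa} (A : CommBimonoid a ℓa) (ψ : CommBimonoid.Carrier A → Carrier)
    (ι : CommBimonoid.Carrier A → P) → (∀ x → φ (ι x) ≈ ψ x) →
    IsEmbedding A D ψ → IsEmbedding A pulledBack ι
  ι-isEmbedding A ψ ι φ-ι ψ-emb = record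
    { cong      = λ e → ≈⇒≋ (through-ψ (Eq.trans (ψ.cong e) (Eq.sym (φ-ι _))))
    ; order-emb = (λ h → ≤⇒≼ (begin
                     φ (ι _) ≈⟨ φ-ι _ ⟩ ψ _ ≤⟨ proj₁ ψ.order-emb h ⟩ ψ _ ≈⟨ Eq.sym (φ-ι _) ⟩ φ (ι _) ∎))
                , (λ h → proj₂ ψ.order-emb (begin
                     ψ _ ≈⟨ Eq.sym (φ-ι _) ⟩ φ (ι _) ≤⟨ ≼⇒≤ h ⟩ φ (ι _) ≈⟨ φ-ι _ ⟩ ψ _ ∎))
    ; pres-·    = λ x y → ≈⇒≋ (through-ψ (Eq.trans (ψ.pres-· x y)
                    (Eq.sym (Eq.trans (φ-∘ _ _) (·-cong (φ-ι x) (φ-ι y))))))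
    ; pres-one  = ≈⇒≋ (through-ψ (Eq.trans ψ.pres-one (Eq.sym φ-one)))
    ; pres-+    = λ x y → ≈⇒≋ (through-ψ (Eq.trans (ψ.pres-+ x y)
                    (Eq.sym (Eq.trans (φ-⊕ _ _) (+-cong (φ-ι x) (φ-ι y))))))
    ; pres-zero = ≈⇒≋ (through-ψ (Eq.trans ψ.pres-zero (Eq.sym φ-zero)))
    }
    where
      module ψ = IsEmbedding ψ-emb
      through-ψ : ∀ {x y} → ψ x ≈ y → φ (ι x) ≈ y
      through-ψ e = Eq.trans (φ-ι _) e

module Fractions {a ℓa d ℓd : Level} (A : CommBimonoid a ℓa)
    (α β : CommBimonoid.Carrier A → CommBimonoid.Carrier A → CommBimonoid.Carrier A)
    (T : TransformationFunctions d ℓd A α β) where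
  private
    module A = CommBimonoid A
  open TransformationFunctions T renaming (comp to ¬_)
  open CommBimonoid D
  open IsDMCompletion isDM
  private
    module j = IsEmbedding embedding
  open Complemented D ¬_ complemented
  open PosetReasoning poset
  open FractionAlgebra A α β

  φ : P → Carrier
  φ (x , y) = j x · ¬ j y

  ≤+⇒·φ≤ : ∀ {p q x y} → p A.· x A.≤ q A.+ y → j p · φ (x , y) ≤ j q
  ≤+⇒·φ≤ {p} {q} {x} {y} h = begin
    j p · (j x · ¬ j y) ≈⟨ Eq.sym (·-assoc _ _ _) ⟩
    j p · j x · ¬ j y   ≤⟨ ≤+⇒·¬≤ (begin
      j p · j x           ≈⟨ Eq.sym (j.pres-· p x) ⟩
      j (p A.· x)         ≤⟨ proj₁ j.order-emb h ⟩
      j (q A.+ y)         ≈⟨ j.pres-+ q y ⟩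
      j q + j y           ∎) ⟩
    j q                 ∎

  ·φ≤⇒≤+ : ∀ {p q x y} → j p · φ (x , y) ≤ j q → p A.· x A.≤ q A.+ y
  ·φ≤⇒≤+ {p} {q} {x} {y} h = proj₂ j.order-emb (begin
    j (p A.· x)   ≈⟨ j.pres-· p x ⟩
    j p · j x     ≤⟨ ·¬≤⇒≤+ (begin
      j p · j x · ¬ j y   ≈⟨ ·-assoc _ _ _ ⟩
      j p · φ (x , y)     ≤⟨ h ⟩
      j q                 ∎) ⟩
    j q + j y     ≈⟨ Eq.sym (j.pres-+ q y) ⟩
    j (q A.+ y)   ∎)

  ≤⇒≼ : ∀ {p q} → φ p ≤ φ q → p ≼ q
  ≤⇒≼ {x , y} {u , v} h x' y' k = ·φ≤⇒≤+ (begin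
    j x' · φ (x , y) ≤⟨ ·-mono ≤-refl h ⟩
    j x' · φ (u , v) ≤⟨ ≤+⇒·φ≤ k ⟩
    j y'             ∎)

  -- φ (x , y) is the meet of the meet-dense elements j y' + ¬ j x' above
  -- φ (u , v), and x' · u ≤ y' + v says exactly that j y' + ¬ j x' is one.
  ≼⇒≤ : ∀ {p q} → p ≼ q → φ p ≤ φ q
  ≼⇒≤ {x , y} {u , v} h = proj₂ (meetDense (φ (u , v))) (φ (x , y)) below-dense-bounds
    where
      below-dense-bounds : ∀ m → (Σ (A.Carrier × A.Carrier) λ (y' , x') →
                             (m ≈ j y' + ¬ j x') × (φ (u , v) ≤ m)) → φ (x , y) ≤ m
      below-dense-bounds m ((y' , x') , m≈ , φuv≤m) = begin
        φ (x , y)   ≤⟨ ·≤⇒≤+¬ (begin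
          φ (x , y) · j x'  ≈⟨ ·-comm _ _ ⟩
          j x' · φ (x , y)  ≤⟨ ≤+⇒·φ≤ (h x' y' (·φ≤⇒≤+ (begin
            j x' · φ (u , v)  ≈⟨ ·-comm _ _ ⟩
            φ (u , v) · j x'  ≤⟨ ≤+¬⇒·≤ (begin φ (u , v) ≤⟨ φuv≤m ⟩ m ≈⟨ m≈ ⟩ j y' + ¬ j x' ∎) ⟩
            j y'              ∎))) ⟩
          j y'              ∎) ⟩
        j y' + ¬ j x' ≈⟨ Eq.sym m≈ ⟩
        m             ∎

  ¬j-zero : ¬ j A.zero ≈ one
  ¬j-zero = Eq.trans (¬-cong j.pres-zero) ¬-zero

  φ-ι÷ : ∀ x → φ (ι÷ x) ≈ j x
  φ-ι÷ x = Eq.trans (·-cong Eq.refl ¬j-zero) (·-identityʳ (j x))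

  φ-one÷ : φ one÷ ≈ one
  φ-one÷ = Eq.trans (φ-ι÷ A.one) j.pres-one

  φ-zero÷ : φ zero÷ ≈ zero
  φ-zero÷ = Eq.trans (φ-ι÷ A.zero) j.pres-zero

  φ-∘ : ∀ p q → φ (p ∘ q) ≈ φ p · φ q
  φ-∘ (x , y) (u , v) = begin-equality
    j (x A.· u) · ¬ j (y A.+ v)   ≈⟨ ·-cong (j.pres-· x u) (Eq.trans (¬-cong (j.pres-+ y v)) (¬-+ _ _)) ⟩
    (j x · j u) · (¬ j y · ¬ j v) ≈⟨ ·-interchange _ _ _ _ ⟩
    φ (x , y) · φ (u , v)         ∎

  φ-bar : ∀ p → φ (bar p) ≈ ¬ φ p
  φ-bar (x , y) = Eq.sym (begin-equality
    ¬ (j x · ¬ j y)                   ≈⟨ ¬-cong (transform x y) ⟩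
    ¬ (j (α x y) + ¬ j (β x y))       ≈⟨ ¬-+ _ _ ⟩
    ¬ j (α x y) · ¬ ¬ j (β x y)       ≈⟨ ·-cong Eq.refl (¬-involutive _) ⟩
    ¬ j (α x y) · j (β x y)           ≈⟨ ·-comm _ _ ⟩
    j (β x y) · ¬ j (α x y)           ∎)

  -- p ⊕ q is bar (bar p ∘ bar q) on the nose, so φ-⊕ is De Morgan.
  φ-⊕ : ∀ p q → φ (p ⊕ q) ≈ φ p + φ q
  φ-⊕ p q = begin-equality
    φ (bar (bar p ∘ bar q))      ≈⟨ φ-bar (bar p ∘ bar q) ⟩
    ¬ φ (bar p ∘ bar q)          ≈⟨ ¬-cong (Eq.trans (φ-∘ (bar p) (bar q)) (·-cong (φ-bar p) (φ-bar q))) ⟩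
    ¬ (¬ φ p · ¬ φ q)            ≈⟨ ¬-· _ _ ⟩
    ¬ ¬ φ p + ¬ ¬ φ q            ≈⟨ +-cong (¬-involutive _) (¬-involutive _) ⟩
    φ p + φ q                    ∎

  open PullBack D _≼_ _∘_ _⊕_ one÷ zero÷ φ ≼⇒≤ ≤⇒≼ φ-∘ φ-⊕ φ-one÷ φ-zero÷ public

  ι÷-·-fraction : ∀ x y → (ι÷ x ∘ bar (ι÷ y)) θ (x , y)
  ι÷-·-fraction x y = ≈⇒≋ (begin-equality
    φ (ι÷ x ∘ bar (ι÷ y)) ≈⟨ Eq.trans (φ-∘ _ _) (·-cong (φ-ι÷ x) (φ-bar (ι÷ y))) ⟩
    j x · ¬ φ (ι÷ y)      ≈⟨ ·-cong Eq.refl (¬-cong (φ-ι÷ y)) ⟩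
    φ (x , y)             ∎)

  ι÷-+-fraction : ∀ x y → (x , y) θ (ι÷ (α x y) ⊕ bar (ι÷ (β x y)))
  ι÷-+-fraction x y = ≈⇒≋ (begin-equality
    φ (x , y)                          ≈⟨ transform x y ⟩
    j (α x y) + ¬ j (β x y)            ≈⟨ Eq.sym (+-cong (φ-ι÷ _) (Eq.trans (φ-bar _) (¬-cong (φ-ι÷ _)))) ⟩
    φ (ι÷ (α x y)) + φ (bar (ι÷ (β x y))) ≈⟨ Eq.sym (φ-⊕ _ _) ⟩
    φ (ι÷ (α x y) ⊕ bar (ι÷ (β x y)))  ∎)

  bar-θ-cong : ∀ p q → p θ q → bar p θ bar q
  bar-θ-cong _ _ = bar-cong ¬_ bar φ-bar ¬-cong

  P/θ-complemented : CommBimonoid.IsComplementation pulledBack bar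
  P/θ-complemented = bar-isComplementation ¬_ bar φ-bar complemented

  isBimonoidOfFractions : IsBimonoidOfFractions A pulledBack bar ι÷
  isBimonoidOfFractions = record
    { complemented = P/θ-complemented
    ; embedding    = ι-isEmbedding A j ι÷ φ-ι÷ embedding
    ; fraction-·   = λ (x , y) → (x , y) , swap (ι÷-·-fraction x y)
    ; fraction-+   = λ (x , y) → (α x y , β x y) , ι÷-+-fraction x y
    }
    where
      swap : ∀ {p q} → p θ q → q θ p
      swap (p≼q , q≼p) = q≼p , p≼q

mainTheorem14 : ∀ {a ℓa d ℓd : Level} (A : CommBimonoid a ℓa)
    (α β : CommBimonoid.Carrier A → CommBimonoid.Carrier A → CommBimonoid.Carrier A) →
    TransformationFunctions d ℓd A α β →
    let open FractionAlgebra A α β in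
    ((∀ p q → p θ q → bar p θ bar q) ×
     Σ (IsCommBimonoid _θ_ _≼_ _∘_ one÷ _⊕_ zero÷) (λ isB →
       IsBimonoidOfFractions A (P/θ isB) bar ι÷ ×
       (∀ x y → (ι÷ x ∘ bar (ι÷ y)) θ (x , y)) ×
       (∀ x y → CommBimonoid.IsComplement (P/θ isB) (x , y) (β x y , α x y))))
mainTheorem14 A α β T =
    bar-θ-cong
  , isCommBimonoid
  , isBimonoidOfFractions
  , ι÷-·-fraction
  , (λ x y → P/θ-complemented (x , y))
  where open Fractions A α β T
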